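{- Let $A=(t_2,t_3,t_4)=(3,6,10)$. For every integer $m\ge 0$ and every $j\in\{1,2,3,4,5\}$, putting $p=(m+1)(5m+2j)/2$, we have \begin{align*} g(3,6,10;p)&=30 m+6j+17\,,\\ n(3,6,10;p)&=30 m+6j+8\,,\\ s(3,6,10;p)&=3\bigl(150 m^2+5(12 j+17)m+6 j^2+17 j+23\bigr)\,. \end{align*}
   Context: For positive integers $a_1,\dots,a_k$ with $\gcd(a_1,\dots,a_k)=1$ and an integer $N$, let $d(N;a_1,\dots,a_k)$ denote the number of $k$-tuples $(x_1,\dots,x_k)$ of nonnegative integers with $a_1x_1+\cdots+a_kx_k=N$. For a nonnegative integer $p$: $g(a_1,\dots,a_k;p)$ is the largest integer $N$ with $d(N;a_1,\dots,a_k)\le p$; $n(a_1,\dots,a_k;p)$ is the number of positive integers $N$ with $d(N;a_1,\dots,a_k)\le p$; and $s(a_1,\dots,a_k;p)$ is the sum of all positive integers $N$ with $d(N;a_1,\dots,a_k)\le p$. Here $t_k=k(k+1)/2$ denotes the $k$-th triangular number. -}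

module Defs where

open import Data.Nat using (ℕ; zero; suc; _+_; _*_; _≤_; _≤?_; _≟_)
open import Data.List using (List; []; _∷_; map; concatMap; length; filter; upTo)
open import Data.Nat.ListAction using (sum)
open import Data.Vec using (Vec; []; _∷_)
open import Relation.Nullary.Decidable using (Dec)

dot : ∀ {k} → Vec ℕ k → Vec ℕ k → ℕ
dot [] [] = 0
dot (a ∷ as) (x ∷ xs) = a * x + dot as xs

boxTuples : (k B : ℕ) → List (Vec ℕ k)
boxTuples zero B = [] ∷ []
boxTuples (suc k) B = concatMap (λ x → map (x ∷_) (boxTuples k B)) (upTo (suc B))

-- d(N; a₁,…,aₖ): number of nonnegative k-tuples x with a·x = N.
-- Since all aᵢ ≥ 1, any solution has xᵢ ≤ N, so enumerating the box [0,N]^k is exhaustive.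
d : ∀ {k} → ℕ → Vec ℕ k → ℕ
d {k} N a = length (filter (λ x → dot a x ≟ N) (boxTuples k N))

repsUpTo : ∀ {k} → Vec ℕ k → ℕ → ℕ → List ℕ
repsUpTo a p B = filter (λ N → d N a ≤? p) (map suc (upTo B))

-- Number / sum of positive N ≤ B with d(N; a) ≤ p.  When B ≥ g(a; p) these are
-- exactly n(a; p) and s(a; p).
nUpTo : ∀ {k} → Vec ℕ k → ℕ → ℕ → ℕ
nUpTo a p B = length (repsUpTo a p B)

sUpTo : ∀ {k} → Vec ℕ k → ℕ → ℕ → ℕ
sUpTo a p B = sum (repsUpTo a p B)

-- G is the largest integer N with d(N; a) ≤ p (stated for G ∈ ℕ; negative N all
-- have d = 0, so a nonnegative G is the largest integer iff it is the largest natural).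
IsG : ∀ {k} → Vec ℕ k → ℕ → ℕ → Set
IsG a p G = (d G a ≤ p) × (∀ N → G Data.Nat.< N → p Data.Nat.< d N a)
  where open import Data.Product using (_×_)

-- Let r(N) = d(N; 3,6,10).  Peeling off the coefficients one at a time gives
-- r(30 + n) = h(n) + r(n) and h(30 + n) = 5 + h(n) for an explicit h, so on each
-- residue class r(30k + c) = r(c) + k h(c) + 5 t_k - 5k is quadratic in k, exactly
-- like p = j(m+1) + 5 t_m.  Comparing r(c) with j and h(c) with j + 5 therefore
-- settles d(N) ≤ p on a whole residue class, and finitely many such checks cover
-- the classes near G = 30m + 6j + 17.  Since r(N) ≤ r(N + 3), they show that
-- d(N) ≤ p exactly when G − N lies in the numerical semigroup ⟨3,10⟩, whose nine
-- gaps give n = G − 9 and s = t_G − 9G + 69.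
module Submission where

open import Defs
open import Data.Nat using (ℕ; zero; suc; _+_; _*_; _∸_; _/_; _≤_; _<_; _≤?_; _<?_; _≟_; z≤n; s≤s; z<s; s<s; NonZero; >-nonZero)
open import Data.Nat.Properties
open import Data.Nat.DivMod using (_%_; m≡m%n+[m/n]*n; m%n<n; m*n/n≡m)
open import Data.Nat.ListAction using (sum)
open import Data.Nat.ListAction.Properties using (sum-++)
open import Data.Nat.Tactic.RingSolver using (solve-∀)
open import Algebra.Properties.CommutativeSemigroup +-commutativeSemigroup using (interchange; x∙yz≈y∙xz)
open import Data.Bool using (true; false; if_then_else_)
open import Data.List using (List; []; _∷_; _++_; _∷ʳ_; map; concatMap; length; filter; upTo; applyUpTo)
open import Data.List.Properties
  using (filter-++; filter-≐; filter-all; filter-none; map-upTo; length-++; length-map; length-applyUpTo; applyUpTo-∷ʳ; ++-identityʳ)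
open import Data.List.Relation.Unary.All using (All; all?; lookup; universal)
open import Data.List.Relation.Unary.All.Properties using (applyUpTo⁻; applyUpTo⁺₁; applyUpTo⁺₂)
open import Data.List.Membership.Propositional using (_∈_; _∉_)
open import Data.List.Membership.DecPropositional _≟_ using (_∈?_)
open import Data.Vec using (Vec; []; _∷_)
import Data.Vec.Relation.Unary.All as Vec
open import Data.Product using (Σ; _×_; _,_; proj₁; proj₂)
open import Data.Unit using (tt)
open import Function using (id; _∘_)
open import Relation.Binary.PropositionalEquality
open import Relation.Nullary using (Dec; does; yes; no; ¬_; ¬?)
open import Relation.Nullary.Decidable using (dec-true; dec-false; toWitness; toWitnessFalse; _×-dec_; _→-dec_)
open import Relation.Unary using (Decidable; _≐_)

sumBelow : ℕ → (ℕ → ℕ) → ℕ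
sumBelow n f = sum (applyUpTo f n)

sumBelow-cong : ∀ n {f g : ℕ → ℕ} → (∀ {i} → i < n → f i ≡ g i) → sumBelow n f ≡ sumBelow n g
sumBelow-cong zero    f≡g = refl
sumBelow-cong (suc n) f≡g = cong₂ _+_ (f≡g z<s) (sumBelow-cong n (f≡g ∘ s<s))

sumBelow-zero : ∀ n {f : ℕ → ℕ} → (∀ i → f i ≡ 0) → sumBelow n f ≡ 0
sumBelow-zero zero    f≡0 = refl
sumBelow-zero (suc n) f≡0 = cong₂ _+_ (f≡0 0) (sumBelow-zero n (f≡0 ∘ suc))

sumBelow-split : ∀ m n (f : ℕ → ℕ) → sumBelow (m + n) f ≡ sumBelow m f + sumBelow n (λ i → f (m + i))
sumBelow-split zero    n f = refl
sumBelow-split (suc m) n f = trans (cong (f 0 +_) (sumBelow-split m n (f ∘ suc))) (sym (+-assoc (f 0) _ _))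

sumBelow-+ : ∀ n (f g : ℕ → ℕ) → sumBelow n (λ i → f i + g i) ≡ sumBelow n f + sumBelow n g
sumBelow-+ zero    f g = refl
sumBelow-+ (suc n) f g = trans (cong (f 0 + g 0 +_) (sumBelow-+ n (f ∘ suc) (g ∘ suc))) (interchange (f 0) (g 0) _ _)

sumBelow-support : ∀ {m n} (f : ℕ → ℕ) → m ≤ n → (∀ {i} → m ≤ i → f i ≡ 0) → sumBelow n f ≡ sumBelow m f
sumBelow-support {m} {n} f m≤n vanish = begin
  sumBelow n f                                        ≡⟨ cong (λ k → sumBelow k f) (m+[n∸m]≡n m≤n) ⟨
  sumBelow (m + (n ∸ m)) f                            ≡⟨ sumBelow-split m (n ∸ m) f ⟩
  sumBelow m f + sumBelow (n ∸ m) (λ i → f (m + i))  ≡⟨ cong (sumBelow m f +_) (sumBelow-zero (n ∸ m) (λ i → vanish (m≤m+n m i))) ⟩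
  sumBelow m f + 0                                    ≡⟨ +-identityʳ _ ⟩
  sumBelow m f                                        ∎
  where open ≡-Reasoning

length-filter-concatMap : ∀ {A B : Set} {P : B → Set} (P? : Decidable P) (f : A → List B) xs →
  length (filter P? (concatMap f xs)) ≡ sum (map (length ∘ filter P? ∘ f) xs)
length-filter-concatMap P? f []       = refl
length-filter-concatMap P? f (x ∷ xs) = begin
  length (filter P? (f x ++ concatMap f xs))                     ≡⟨ cong length (filter-++ P? (f x) _) ⟩
  length (filter P? (f x) ++ filter P? (concatMap f xs))         ≡⟨ length-++ (filter P? (f x)) ⟩
  length (filter P? (f x)) + length (filter P? (concatMap f xs)) ≡⟨ cong (_ +_) (length-filter-concatMap P? f xs) ⟩
  sum (map (length ∘ filter P? ∘ f) (x ∷ xs))                    ∎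
  where open ≡-Reasoning

filter-map : ∀ {A B : Set} {P : B → Set} (P? : Decidable P) (f : A → B) xs →
  filter P? (map f xs) ≡ map f (filter (P? ∘ f) xs)
filter-map P? f []       = refl
filter-map P? f (x ∷ xs) with does (P? (f x))
... | true  = cong (f x ∷_) (filter-map P? f xs)
... | false = filter-map P? f xs

applyUpTo-+ : ∀ {A : Set} (f : ℕ → A) m n → applyUpTo f (m + n) ≡ applyUpTo f m ++ applyUpTo (λ i → f (m + i)) n
applyUpTo-+ f zero    n = refl
applyUpTo-+ f (suc m) n = cong (f 0 ∷_) (applyUpTo-+ (f ∘ suc) m n)

sum-map-+ : ∀ n xs → sum (map (n +_) xs) ≡ length xs * n + sum xs
sum-map-+ n []       = refl
sum-map-+ n (x ∷ xs) = trans (cong (n + x +_) (sum-map-+ n xs)) (arith n x (length xs * n) (sum xs))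
  where
  arith : ∀ n x l s → n + x + (l + s) ≡ n + l + (x + s)
  arith = solve-∀

triangular : ℕ → ℕ
triangular zero    = 0
triangular (suc n) = suc n + triangular n

triangular-double : ∀ n → triangular n * 2 ≡ n * suc n
triangular-double zero    = refl
triangular-double (suc n) =
  trans (*-distribʳ-+ 2 (suc n) (triangular n)) (trans (cong (suc n * 2 +_) (triangular-double n)) (arith n))
  where
  arith : ∀ n → suc n * 2 + n * suc n ≡ suc n * suc (suc n)
  arith = solve-∀

sum-applyUpTo-suc : ∀ n → sum (applyUpTo suc n) ≡ triangular n
sum-applyUpTo-suc zero    = refl
sum-applyUpTo-suc (suc n) = begin
  sum (applyUpTo suc (suc n))          ≡⟨ cong sum (applyUpTo-∷ʳ suc n) ⟨
  sum (applyUpTo suc n ∷ʳ suc n)       ≡⟨ sum-++ (applyUpTo suc n) (suc n ∷ []) ⟩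
  sum (applyUpTo suc n) + (suc n + 0)  ≡⟨ cong₂ _+_ (sum-applyUpTo-suc n) (+-identityʳ (suc n)) ⟩
  triangular n + suc n                 ≡⟨ +-comm (triangular n) (suc n) ⟩
  triangular (suc n)                   ∎
  where open ≡-Reasoning

Periodic : ℕ → (ℕ → ℕ) → Set
Periodic P f = ∀ n → f (P + n) ≡ f n

periodic-iterate : ∀ {P} {f : ℕ → ℕ} → Periodic P f → ∀ k n → f (k * P + n) ≡ f n
periodic-iterate         per zero    n = refl
periodic-iterate {P} {f} per (suc k) n =
  trans (cong f (+-assoc P (k * P) n)) (trans (per (k * P + n)) (periodic-iterate {P} {f} per k n))

periodic-shift : ∀ {P} {f : ℕ → ℕ} → Periodic P f → ∀ m n → f (m + (P + n)) ≡ f (m + n)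
periodic-shift {P} {f} per m n = trans (cong f (x∙yz≈y∙xz m P n)) (per (m + n))

periodic-const : ∀ P .{{_ : NonZero P}} {f : ℕ → ℕ} {c} → Periodic P f → (∀ {r} → r < P → f r ≡ c) → ∀ n → f n ≡ c
periodic-const P {f} per base n = begin
  f n                   ≡⟨ cong f (trans (m≡m%n+[m/n]*n n P) (+-comm (n % P) _)) ⟩
  f (n / P * P + n % P) ≡⟨ periodic-iterate {P} {f} per (n / P) (n % P) ⟩
  f (n % P)             ≡⟨ base (m%n<n n P) ⟩
  _                     ∎
  where open ≡-Reasoning

linear-iterate : ∀ {P e} {h : ℕ → ℕ} → (∀ n → h (P + n) ≡ e + h n) → ∀ k n → h (k * P + n) ≡ e * k + h n
linear-iterate {P} {e} {h} step zero    n = cong (_+ h n) (sym (*-zeroʳ e))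
linear-iterate {P} {e} {h} step (suc k) n = begin
  h (P + k * P + n)     ≡⟨ cong h (+-assoc P (k * P) n) ⟩
  h (P + (k * P + n))   ≡⟨ step (k * P + n) ⟩
  e + h (k * P + n)     ≡⟨ cong (e +_) (linear-iterate {P} {e} {h} step k n) ⟩
  e + (e * k + h n)     ≡⟨ arith e k (h n) ⟩
  e * suc k + h n       ∎
  where
  open ≡-Reasoning
  arith : ∀ e k x → e + (e * k + x) ≡ e * suc k + x
  arith = solve-∀

quadratic-iterate : ∀ {P e} {f h : ℕ → ℕ} → (∀ n → f (P + n) ≡ h n + f n) → (∀ n → h (P + n) ≡ e + h n) →
  ∀ k n → f (k * P + n) + e * k ≡ f n + k * h n + e * triangular k
quadratic-iterate {P} {e} {f} {h} fstep hstep zero    n = cong (_+ e * 0) (sym (+-identityʳ (f n)))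
quadratic-iterate {P} {e} {f} {h} fstep hstep (suc k) n = begin
  f (P + k * P + n) + e * suc k                          ≡⟨ cong (λ x → f x + e * suc k) (+-assoc P (k * P) n) ⟩
  f (P + (k * P + n)) + e * suc k                        ≡⟨ cong (_+ e * suc k) (fstep (k * P + n)) ⟩
  h (k * P + n) + f (k * P + n) + e * suc k              ≡⟨ cong (λ x → x + f (k * P + n) + e * suc k) (linear-iterate {P} {e} {h} hstep k n) ⟩
  e * k + h n + f (k * P + n) + e * suc k                ≡⟨ regroup (e * k) (h n) (f (k * P + n)) e k ⟩
  (f (k * P + n) + e * k) + (h n + e * suc k)            ≡⟨ cong (_+ (h n + e * suc k)) (quadratic-iterate {P} {e} {f} {h} fstep hstep k n) ⟩
  (f n + k * h n + e * triangular k) + (h n + e * suc k) ≡⟨ collect (f n) (h n) e k (triangular k) ⟩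
  f n + suc k * h n + e * (suc k + triangular k)         ∎
  where
  open ≡-Reasoning
  regroup : ∀ ek y F e k → ek + y + F + e * suc k ≡ (F + ek) + (y + e * suc k)
  regroup = solve-∀
  collect : ∀ x y e k t → (x + k * y + e * t) + (y + e * suc k) ≡ x + suc k * y + e * (suc k + t)
  collect = solve-∀

mono-along-steps : ∀ {s} {f : ℕ → ℕ} → (∀ n → f n ≤ f (s + n)) → ∀ k n → f n ≤ f (k * s + n)
mono-along-steps         step zero    n = ≤-refl
mono-along-steps {s} {f} step (suc k) n = ≤-trans (mono-along-steps {s} {f} step k n)
  (≤-trans (step (k * s + n)) (≤-reflexive (cong f (sym (+-assoc s (k * s) n)))))

guarded : ℕ → (ℕ → ℕ) → ℕ → ℕ → ℕ
guarded a g N x = if does (x * a ≤? N) then g (N ∸ x * a) else 0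

layer : ℕ → (ℕ → ℕ) → ℕ → ℕ
layer a g N = sumBelow (suc N) (guarded a g N)

guarded-≤ : ∀ a g {N x} → x * a ≤ N → guarded a g N x ≡ g (N ∸ x * a)
guarded-≤ a g {N} {x} le = cong (λ b → if b then g (N ∸ x * a) else 0) (dec-true (x * a ≤? N) le)

guarded-≰ : ∀ a g {N x} → ¬ x * a ≤ N → guarded a g N x ≡ 0
guarded-≰ a g {N} {x} ¬le = cong (λ b → if b then g (N ∸ x * a) else 0) (dec-false (x * a ≤? N) ¬le)

guarded-cong : ∀ a {g h N} x → (∀ {M} → M ≤ N → g M ≡ h M) → guarded a g N x ≡ guarded a h N x
guarded-cong a {g} {h} {N} x g≡h with x * a ≤? N
... | yes le = trans (guarded-≤ a g {N} {x} le) (trans (g≡h (m∸n≤m N (x * a))) (sym (guarded-≤ a h {N} {x} le)))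
... | no ¬le = trans (guarded-≰ a g {N} {x} ¬le) (sym (guarded-≰ a h {N} {x} ¬le))

guarded-vanish : ∀ {a} g {N x} → 1 ≤ a → N < x → guarded a g N x ≡ 0
guarded-vanish {a} g {N} {x} a≥1 N<x = guarded-≰ a g {N} {x} (<⇒≱ (≤-trans N<x (m≤m*n x a {{>-nonZero a≥1}})))

guarded-suc : ∀ a g N x → guarded a g (a + N) (suc x) ≡ guarded a g N x
guarded-suc a g N x with x * a ≤? N
... | yes le = begin
  guarded a g (a + N) (suc x) ≡⟨ guarded-≤ a g {a + N} {suc x} (+-monoʳ-≤ a le) ⟩
  g (a + N ∸ (a + x * a))     ≡⟨ cong g ([m+n]∸[m+o]≡n∸o a N (x * a)) ⟩
  g (N ∸ x * a)               ≡⟨ guarded-≤ a g {N} {x} le ⟨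
  guarded a g N x             ∎
  where open ≡-Reasoning
... | no ¬le = trans (guarded-≰ a g {a + N} {suc x} (¬le ∘ +-cancelˡ-≤ a _ _)) (sym (guarded-≰ a g {N} {x} ¬le))

layer-step : ∀ a g → 1 ≤ a → ∀ N → layer a g (a + N) ≡ g (a + N) + layer a g N
layer-step a g a≥1 N = cong (g (a + N) +_) (begin
  sumBelow (a + N) (guarded a g (a + N) ∘ suc) ≡⟨ sumBelow-cong (a + N) (λ {x} _ → guarded-suc a g N x) ⟩
  sumBelow (a + N) (guarded a g N)             ≡⟨ sumBelow-support (guarded a g N) (+-monoˡ-≤ N a≥1) (guarded-vanish g a≥1) ⟩
  layer a g N                                  ∎)
  where open ≡-Reasoning

layer-iterate : ∀ a g → 1 ≤ a → ∀ n N →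
  layer a g (n * a + N) ≡ sumBelow n (λ i → g ((n ∸ i) * a + N)) + layer a g N
layer-iterate a g a≥1 zero    N = refl
layer-iterate a g a≥1 (suc n) N = begin
  layer a g (a + n * a + N)                                   ≡⟨ cong (layer a g) (+-assoc a (n * a) N) ⟩
  layer a g (a + (n * a + N))                                 ≡⟨ layer-step a g a≥1 (n * a + N) ⟩
  g (a + (n * a + N)) + layer a g (n * a + N)                 ≡⟨ cong₂ _+_ (cong g (sym (+-assoc a (n * a) N))) (layer-iterate a g a≥1 n N) ⟩
  g (suc n * a + N) + (sumBelow n (λ i → g ((n ∸ i) * a + N)) + layer a g N)
                                                              ≡⟨ +-assoc (g (suc n * a + N)) _ _ ⟨
  sumBelow (suc n) (λ i → g ((suc n ∸ i) * a + N)) + layer a g N ∎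
  where open ≡-Reasoning

reps : ∀ {k} → Vec ℕ k → ℕ → ℕ
reps []       zero    = 1
reps []       (suc _) = 0
reps (a ∷ as)         = layer a (reps as)

boxCount : ∀ {k} → ℕ → Vec ℕ k → ℕ → ℕ
boxCount {k} B a N = length (filter (λ x → dot a x ≟ N) (boxTuples k B))

boxCount-∷ : ∀ {k} B a (as : Vec ℕ k) N → boxCount B (a ∷ as) N ≡ sumBelow (suc B) (guarded a (boxCount B as) N)
boxCount-∷ {k} B a as N = begin
  length (filter P? (concatMap (λ x → map (x ∷_) box) (upTo (suc B))))
      ≡⟨ length-filter-concatMap P? (λ x → map (x ∷_) box) (upTo (suc B)) ⟩
  sum (map (λ x → length (filter P? (map (x ∷_) box))) (upTo (suc B)))
      ≡⟨ cong sum (map-upTo _ (suc B)) ⟩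
  sumBelow (suc B) (λ x → length (filter P? (map (x ∷_) box)))
      ≡⟨ sumBelow-cong (suc B) (λ {x} _ → trans (cong length (filter-map P? (x ∷_) box)) (trans (length-map (x ∷_) (filter (P? ∘ (x ∷_)) box)) (row x))) ⟩
  sumBelow (suc B) (guarded a (boxCount B as) N) ∎
  where
  open ≡-Reasoning
  box = boxTuples k B
  P? = λ (v : Vec ℕ (suc k)) → dot (a ∷ as) v ≟ N
  row : ∀ x → length (filter (λ v → a * x + dot as v ≟ N) box) ≡ guarded a (boxCount B as) N x
  row x with x * a ≤? N
  ... | yes le = trans (cong length (filter-≐ _ _ (forward , backward) box)) (sym (guarded-≤ a (boxCount B as) {N} {x} le))
    where
    forward : ∀ {v} → a * x + dot as v ≡ N → dot as v ≡ N ∸ x * a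
    forward {v} eq = sym (trans (cong (_∸ x * a) (trans (sym eq) (cong (_+ dot as v) (*-comm a x))))
                                (m+n∸m≡n (x * a) (dot as v)))
    backward : ∀ {v} → dot as v ≡ N ∸ x * a → a * x + dot as v ≡ N
    backward eq = trans (cong₂ _+_ (*-comm a x) eq) (m+[n∸m]≡n le)
  ... | no ¬le = trans (cong length (filter-none _ (universal absent box))) (sym (guarded-≰ a (boxCount B as) {N} {x} ¬le))
    where
    absent : ∀ v → ¬ (a * x + dot as v ≡ N)
    absent v eq = ¬le (subst (_≤ N) (*-comm a x) (≤-trans (m≤m+n (a * x) (dot as v)) (≤-reflexive eq)))

boxCount≡reps : ∀ {k} B (a : Vec ℕ k) → Vec.All (1 ≤_) a → ∀ {N} → N ≤ B → boxCount B a N ≡ reps a N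
boxCount≡reps B []       Vec.[]             {zero}  _ = refl
boxCount≡reps B []       Vec.[]             {suc N} _ = refl
boxCount≡reps B (a ∷ as) (a≥1 Vec.∷ as≥1) {N}     N≤B = begin
  boxCount B (a ∷ as) N                           ≡⟨ boxCount-∷ B a as N ⟩
  sumBelow (suc B) (guarded a (boxCount B as) N)  ≡⟨ sumBelow-cong (suc B) (λ {x} _ → guarded-cong a x inner) ⟩
  sumBelow (suc B) (guarded a (reps as) N)        ≡⟨ sumBelow-support (guarded a (reps as) N) (s≤s N≤B) (guarded-vanish (reps as) a≥1) ⟩
  reps (a ∷ as) N                                 ∎
  where
  open ≡-Reasoning
  inner : ∀ {M} → M ≤ N → boxCount B as M ≡ reps as M
  inner M≤N = boxCount≡reps B as as≥1 (≤-trans M≤N N≤B)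

d≡reps : ∀ {k} (a : Vec ℕ k) → Vec.All (1 ≤_) a → ∀ N → d N a ≡ reps a N
d≡reps a a≥1 N = boxCount≡reps N a a≥1 ≤-refl

A : Vec ℕ 3
A = 3 ∷ 6 ∷ 10 ∷ []

r₁ r₂ r₃ : ℕ → ℕ
r₁ = reps (10 ∷ [])
r₂ = reps (6 ∷ 10 ∷ [])
r₃ = reps A

d≡r₃ : ∀ N → d N A ≡ r₃ N
d≡r₃ = d≡reps A (s≤s z≤n Vec.∷ s≤s z≤n Vec.∷ s≤s z≤n Vec.∷ Vec.[])

h₂ h₃ : ℕ → ℕ
h₂ n = sumBelow 5 (λ i → r₁ ((5 ∸ i) * 6 + n))
h₃ n = sumBelow 10 (λ i → r₂ ((10 ∸ i) * 3 + n))

r₁-periodic : Periodic 10 r₁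
r₁-periodic = layer-step 10 (reps []) (s≤s z≤n)

r₂-step : ∀ n → r₂ (30 + n) ≡ h₂ n + r₂ n
r₂-step = layer-iterate 6 r₁ (s≤s z≤n) 5

r₃-step : ∀ n → r₃ (30 + n) ≡ h₃ n + r₃ n
r₃-step = layer-iterate 3 r₂ (s≤s z≤n) 10

r₃-mono-3 : ∀ n → r₃ n ≤ r₃ (3 + n)
r₃-mono-3 n = ≤-trans (m≤n+m (r₃ n) (r₂ (3 + n))) (≤-reflexive (sym (layer-step 3 r₂ (s≤s z≤n) n)))

h₂-periodic : Periodic 10 h₂
h₂-periodic n = sumBelow-cong 5 (λ {i} _ → periodic-shift {10} {r₁} r₁-periodic ((5 ∸ i) * 6) n)

-- The ten shifts 3, 6, …, 30 run through all residues mod 10, so each of the five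
-- terms of h₂ meets exactly one multiple of 10.
h₂-residue-sum : ∀ n → sumBelow 10 (λ i → h₂ ((10 ∸ i) * 3 + n)) ≡ 5
h₂-residue-sum = periodic-const 10 {F} periodic (applyUpTo⁻ id 10 (toWitness {a? = all? (λ r → F r ≟ 5) (upTo 10)} tt))
  where
  F : ℕ → ℕ
  F n = sumBelow 10 (λ i → h₂ ((10 ∸ i) * 3 + n))
  periodic : Periodic 10 F
  periodic n = sumBelow-cong 10 (λ {i} _ → periodic-shift {10} {h₂} h₂-periodic ((10 ∸ i) * 3) n)

h₃-step : ∀ n → h₃ (30 + n) ≡ 5 + h₃ n
h₃-step n = begin
  sumBelow 10 (λ i → r₂ (s i + (30 + n)))          ≡⟨ sumBelow-cong 10 (λ {i} _ → trans (cong r₂ (x∙yz≈y∙xz (s i) 30 n)) (r₂-step (s i + n))) ⟩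
  sumBelow 10 (λ i → h₂ (s i + n) + r₂ (s i + n))  ≡⟨ sumBelow-+ 10 (λ i → h₂ (s i + n)) (λ i → r₂ (s i + n)) ⟩
  sumBelow 10 (λ i → h₂ (s i + n)) + h₃ n          ≡⟨ cong (_+ h₃ n) (h₂-residue-sum n) ⟩
  5 + h₃ n                                         ∎
  where
  open ≡-Reasoning
  s : ℕ → ℕ
  s i = (10 ∸ i) * 3

r₃-formula : ∀ m c → r₃ (m * 30 + c) + 5 * m ≡ r₃ c + m * h₃ c + 5 * triangular m
r₃-formula = quadratic-iterate {30} {5} {r₃} {h₃} r₃-step h₃-step

level : ℕ → ℕ → ℕ
level m j = j * suc m + 5 * triangular m

half-level : ∀ m j → (m + 1) * (5 * m + 2 * j) / 2 ≡ level m j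
half-level m j = trans (cong (_/ 2) double) (m*n/n≡m (level m j) 2)
  where
  open ≡-Reasoning
  expand : ∀ m j → (m + 1) * (5 * m + 2 * j) ≡ j * suc m * 2 + 5 * (m * suc m)
  expand = solve-∀
  collect : ∀ j m t → j * suc m * 2 + 5 * (t * 2) ≡ (j * suc m + 5 * t) * 2
  collect = solve-∀
  double : (m + 1) * (5 * m + 2 * j) ≡ level m j * 2
  double = begin
    (m + 1) * (5 * m + 2 * j)               ≡⟨ expand m j ⟩
    j * suc m * 2 + 5 * (m * suc m)         ≡⟨ cong (λ x → j * suc m * 2 + 5 * x) (triangular-double m) ⟨
    j * suc m * 2 + 5 * (triangular m * 2)  ≡⟨ collect j m (triangular m) ⟩
    level m j * 2                           ∎

level-shape : ∀ m j → j + m * (5 + j) + 5 * triangular m ≡ level m j + 5 * m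
level-shape m j = arith m j (triangular m)
  where
  arith : ∀ m j t → j + m * (5 + j) + 5 * t ≡ j * suc m + 5 * t + 5 * m
  arith = solve-∀

Below Above : ℕ → ℕ → Set
Below j c = r₃ c ≤ j × h₃ c ≤ 5 + j
Above j c = j < r₃ c × 5 + j ≤ h₃ c

below⇒≤level : ∀ {j c} → Below j c → ∀ m → r₃ (m * 30 + c) ≤ level m j
below⇒≤level {j} {c} (r≤j , h≤5+j) m = +-cancelʳ-≤ (5 * m) _ _ (begin
  r₃ (m * 30 + c) + 5 * m             ≡⟨ r₃-formula m c ⟩
  r₃ c + m * h₃ c + 5 * triangular m  ≤⟨ +-monoˡ-≤ (5 * triangular m) (+-mono-≤ r≤j (*-monoʳ-≤ m h≤5+j)) ⟩
  j + m * (5 + j) + 5 * triangular m  ≡⟨ level-shape m j ⟩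
  level m j + 5 * m                   ∎)
  where open ≤-Reasoning

above⇒level< : ∀ {j c} → Above j c → ∀ m → level m j < r₃ (m * 30 + c)
above⇒level< {j} {c} (j<r , 5+j≤h) m = +-cancelʳ-< (5 * m) _ _ (begin-strict
  level m j + 5 * m                   ≡⟨ level-shape m j ⟨
  j + m * (5 + j) + 5 * triangular m  <⟨ +-monoˡ-< (5 * triangular m) (+-mono-<-≤ j<r (*-monoʳ-≤ m 5+j≤h)) ⟩
  r₃ c + m * h₃ c + 5 * triangular m  ≡⟨ r₃-formula m c ⟨
  r₃ (m * 30 + c) + 5 * m             ∎)
  where open ≤-Reasoning

-- The numbers that are not of the form 3a + 10b.
gaps : List ℕ
gaps = 1 ∷ 2 ∷ 4 ∷ 5 ∷ 7 ∷ 8 ∷ 11 ∷ 14 ∷ 17 ∷ []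

gaps-<18 : All (_< 18) gaps
gaps-<18 = toWitness {a? = all? (_<? 18) gaps} tt

gaps-≥18 : ∀ {e} → 18 ≤ e → e ∉ gaps
gaps-≥18 18≤e e∈gaps = <⇒≱ (lookup gaps-<18 e∈gaps) 18≤e

Reaches : ℕ → ℕ → Set
Reaches G N = N ≤ G × G ∸ N ∉ gaps

Reaches? : ∀ G → Decidable (Reaches G)
Reaches? G N = (N ≤? G) ×-dec ¬? (G ∸ N ∈? gaps)

reaches-translate : ∀ W → (Reaches (W + 17) ∘ (W +_)) ≐ Reaches 17
reaches-translate W =
    (λ { {k} (le , gap) → +-cancelˡ-≤ W k 17 le , subst (_∉ gaps) ([m+n]∸[m+o]≡n∸o W 17 k) gap })
  , (λ { {k} (le , gap) → +-monoʳ-≤ W le , subst (_∉ gaps) (sym ([m+n]∸[m+o]≡n∸o W 17 k)) gap })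

-- The window of 18 numbers below the threshold is translated to threshold 17, where its
-- survivors are computed to be the gaps themselves (⟨3,10⟩ is symmetric: e ∉ gaps ⇔ 17 − e ∈ gaps).
reachers : ∀ V t → filter (Reaches? (suc V + 17)) (applyUpTo suc (V + (18 + t))) ≡ applyUpTo suc V ++ map (suc V +_) gaps
reachers V t = begin
  filter R? (applyUpTo suc (V + (18 + t)))
      ≡⟨ cong (filter R?) (trans (applyUpTo-+ suc V (18 + t)) (cong (applyUpTo suc V ++_) (applyUpTo-+ (suc V +_) 18 t))) ⟩
  filter R? (applyUpTo suc V ++ (applyUpTo (suc V +_) 18 ++ far))
      ≡⟨ trans (filter-++ R? (applyUpTo suc V) (applyUpTo (suc V +_) 18 ++ far))
               (cong (filter R? (applyUpTo suc V) ++_) (filter-++ R? (applyUpTo (suc V +_) 18) far)) ⟩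
  filter R? (applyUpTo suc V) ++ (filter R? (applyUpTo (suc V +_) 18) ++ filter R? far)
      ≡⟨ cong₂ _++_ low (cong₂ _++_ window high) ⟩
  applyUpTo suc V ++ (map (suc V +_) gaps ++ [])
      ≡⟨ cong (applyUpTo suc V ++_) (++-identityʳ _) ⟩
  applyUpTo suc V ++ map (suc V +_) gaps ∎
  where
  open ≡-Reasoning
  R? = Reaches? (suc V + 17)
  far = applyUpTo (λ i → suc V + (18 + i)) t
  low : filter R? (applyUpTo suc V) ≡ applyUpTo suc V
  low = filter-all R? (applyUpTo⁺₁ suc V λ {i} i<V →
      ≤-trans i<V (≤-trans (n≤1+n V) (m≤m+n (suc V) 17))
    , gaps-≥18 (m+n≤o⇒m≤o∸n 18 (≤-trans (+-monoʳ-≤ 18 i<V) (≤-reflexive (cong suc (+-comm 17 V))))))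
  window : filter R? (applyUpTo (suc V +_) 18) ≡ map (suc V +_) gaps
  window = begin
    filter R? (applyUpTo (suc V +_) 18)                  ≡⟨ cong (filter R?) (map-upTo (suc V +_) 18) ⟨
    filter R? (map (suc V +_) (upTo 18))                 ≡⟨ filter-map R? (suc V +_) (upTo 18) ⟩
    map (suc V +_) (filter (R? ∘ (suc V +_)) (upTo 18))  ≡⟨ cong (map (suc V +_)) (filter-≐ (R? ∘ (suc V +_)) (Reaches? 17) (reaches-translate (suc V)) (upTo 18)) ⟩
    map (suc V +_) (filter (Reaches? 17) (upTo 18))      ≡⟨⟩
    map (suc V +_) gaps                                  ∎
  high : filter R? far ≡ []
  high = filter-none R? (applyUpTo⁺₂ _ t λ i (le , _) → <⇒≱ (s≤s (+-monoʳ-< V (s≤s (m≤m+n 17 i)))) le)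

c₀ : ℕ → ℕ
c₀ j = 17 + 6 * j

-- Entry e concerns N = G − e: a gap must lie above the level, a non-gap below it.
-- By r₃-mono-3 the remaining non-gaps reduce to e ∈ {18, 19, 20} and N > G to G + 1, G + 2, G + 3.
Verdict : ℕ → ℕ → Set
Verdict j e = (e ∈ gaps → Above j (c₀ j ∸ e)) × (e ∉ gaps → Below j (c₀ j ∸ e))

Table : ℕ → Set
Table j = All (Verdict j) (upTo 21) × All (λ i → Above j (c₀ j + i)) (applyUpTo suc 3)

table? : ∀ j → Dec (Table j)
table? j = all? verdict? (upTo 21) ×-dec all? (λ i → above? (c₀ j + i)) (applyUpTo suc 3)
  where
  below? above? : ∀ c → Dec _
  below? c = (r₃ c ≤? j) ×-dec (h₃ c ≤? 5 + j)
  above? c = (suc j ≤? r₃ c) ×-dec (5 + j ≤? h₃ c)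
  verdict? : ∀ e → Dec (Verdict j e)
  verdict? e = ((e ∈? gaps) →-dec above? (c₀ j ∸ e)) ×-dec (¬? (e ∈? gaps) →-dec below? (c₀ j ∸ e))

table : ∀ {i} → i < 5 → Table (suc i)
table {0} _ = toWitness {a? = table? 1} tt
table {1} _ = toWitness {a? = table? 2} tt
table {2} _ = toWitness {a? = table? 3} tt
table {3} _ = toWitness {a? = table? 4} tt
table {4} _ = toWitness {a? = table? 5} tt
table {suc (suc (suc (suc (suc _))))} (s≤s (s≤s (s≤s (s≤s (s≤s ())))))

nongap-descent : ∀ {e} → e ∉ gaps → Σ ℕ λ a → Σ ℕ λ e′ → a * 3 + e′ ≡ e × e′ < 21 × e′ ∉ gaps
nongap-descent {e} e∉gaps with e <? 21
... | yes e<21 = 0 , e , refl , e<21 , e∉gaps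
... | no e≮21  = t / 3 , 18 + t % 3 , eq , +-monoʳ-< 18 (m%n<n t 3) , gaps-≥18 (m≤m+n 18 (t % 3))
  where
  t = e ∸ 18
  arith : ∀ a r → a * 3 + (18 + r) ≡ 18 + (r + a * 3)
  arith = solve-∀
  eq : t / 3 * 3 + (18 + t % 3) ≡ e
  eq = begin
    t / 3 * 3 + (18 + t % 3)  ≡⟨ arith (t / 3) (t % 3) ⟩
    18 + (t % 3 + t / 3 * 3)  ≡⟨ cong (18 +_) (m≡m%n+[m/n]*n t 3) ⟨
    18 + t                    ≡⟨ m+[n∸m]≡n (≤-trans (m≤m+n 18 3) (≮⇒≥ e≮21)) ⟩
    e                         ∎
    where open ≡-Reasoning

m+n≡o+p⇒m≡o+[p∸n] : ∀ {m n o p} → m + n ≡ o + p → n ≤ p → m ≡ o + (p ∸ n)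
m+n≡o+p⇒m≡o+[p∸n] {m} {n} {o} {p} eq n≤p =
  +-cancelʳ-≡ n m (o + (p ∸ n)) (trans eq (trans (cong (o +_) (sym (m∸n+n≡m n≤p))) (sym (+-assoc o (p ∸ n) n))))

module Threshold (i m : ℕ) (tbl : Table (suc i)) where

  j p V G : ℕ
  j = suc i
  p = level m j
  V = m * 30 + 5 + 6 * i
  G = suc V + 17

  G≡ : G ≡ m * 30 + c₀ j
  G≡ = arith m i
    where
    arith : ∀ m i → suc (m * 30 + 5 + 6 * i) + 17 ≡ m * 30 + (17 + 6 * suc i)
    arith = solve-∀

  window-verdict : ∀ {e} → e < 21 → Verdict j e
  window-verdict = applyUpTo⁻ id 21 (proj₁ tbl)

  window-offset : ∀ {N e} → N + e ≡ G → e < 21 → N ≡ m * 30 + (c₀ j ∸ e)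
  window-offset eq e<21 =
    m+n≡o+p⇒m≡o+[p∸n] (trans eq G≡) (≤-trans (<⇒≤ e<21) (≤-trans (m≤m+n 21 2) (+-monoʳ-≤ 17 (m≤m*n 6 j))))

  gap⇒above : ∀ {N e} → N + e ≡ G → e ∈ gaps → p < r₃ N
  gap⇒above eq e∈gaps =
    subst (λ x → p < r₃ x) (sym (window-offset eq e<21)) (above⇒level< (proj₁ (window-verdict e<21) e∈gaps) m)
    where
    e<21 = ≤-trans (lookup gaps-<18 e∈gaps) (m≤m+n 18 3)

  window-below : ∀ {N e} → N + e ≡ G → e < 21 → e ∉ gaps → r₃ N ≤ p
  window-below eq e<21 e∉gaps =
    subst (λ x → r₃ x ≤ p) (sym (window-offset eq e<21)) (below⇒≤level (proj₂ (window-verdict e<21) e∉gaps) m)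

  nongap⇒below : ∀ {N e} → N + e ≡ G → e ∉ gaps → r₃ N ≤ p
  nongap⇒below {N} {e} eq e∉gaps =
    ≤-trans (mono-along-steps {3} {r₃} r₃-mono-3 a N) (window-below eq′ e′<21 e′∉gaps)
    where
    descent = nongap-descent e∉gaps
    a e′ : ℕ
    a = proj₁ descent
    e′ = proj₁ (proj₂ descent)
    e′<21 = proj₁ (proj₂ (proj₂ (proj₂ descent)))
    e′∉gaps = proj₂ (proj₂ (proj₂ (proj₂ descent)))
    eq′ : a * 3 + N + e′ ≡ G
    eq′ = trans (+-assoc (a * 3) N e′)
                (trans (x∙yz≈y∙xz (a * 3) N e′) (trans (cong (N +_) (proj₁ (proj₂ (proj₂ descent)))) eq))

  beyond⇒above : ∀ {N} → G < N → p < r₃ N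
  beyond⇒above {N} G<N = <-≤-trans (above⇒level< (applyUpTo⁻ suc 3 (proj₂ tbl) (m%n<n t 3)) m)
    (≤-trans (mono-along-steps {3} {r₃} r₃-mono-3 (t / 3) _) (≤-reflexive (cong r₃ eq)))
    where
    t = N ∸ suc G
    arith : ∀ a M c r → a * 3 + (M + (c + suc r)) ≡ suc (M + c) + (r + a * 3)
    arith = solve-∀
    eq : t / 3 * 3 + (m * 30 + (c₀ j + suc (t % 3))) ≡ N
    eq = begin
      t / 3 * 3 + (m * 30 + (c₀ j + suc (t % 3)))  ≡⟨ arith (t / 3) (m * 30) (c₀ j) (t % 3) ⟩
      suc (m * 30 + c₀ j) + (t % 3 + t / 3 * 3)    ≡⟨ cong₂ (λ x y → suc x + y) (sym G≡) (sym (m≡m%n+[m/n]*n t 3)) ⟩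
      suc G + t                                    ≡⟨ m+[n∸m]≡n G<N ⟩
      N                                            ∎
      where open ≡-Reasoning

  characterization : (λ N → d N A ≤ p) ≐ Reaches G
  characterization = to , from
    where
    to : ∀ {N} → d N A ≤ p → Reaches G N
    to {N} d≤p = N≤G , λ gap → <⇒≱ (gap⇒above (m+[n∸m]≡n N≤G) gap) r≤p
      where
      r≤p = subst (_≤ p) (d≡r₃ N) d≤p
      N≤G = ≮⇒≥ (λ G<N → <⇒≱ (beyond⇒above G<N) r≤p)
    from : ∀ {N} → Reaches G N → d N A ≤ p
    from {N} (N≤G , nongap) = subst (_≤ p) (sym (d≡r₃ N)) (nongap⇒below (m+[n∸m]≡n N≤G) nongap)

  isG : IsG A p G
  isG = proj₂ characterization (≤-refl , subst (_∉ gaps) (sym (n∸n≡0 G)) (toWitnessFalse {a? = 0 ∈? gaps} tt))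
      , λ N G<N → ≰⇒> (λ d≤p → <⇒≱ G<N (proj₁ (proj₁ characterization d≤p)))

  solutions : ∀ {B} → G ≤ B → repsUpTo A p B ≡ applyUpTo suc V ++ map (suc V +_) gaps
  solutions {B} G≤B = begin
    filter (λ N → d N A ≤? p) (map suc (upTo B))
        ≡⟨ filter-≐ (λ N → d N A ≤? p) (Reaches? G) characterization (map suc (upTo B)) ⟩
    filter (Reaches? G) (map suc (upTo B))
        ≡⟨ cong (filter (Reaches? G)) (trans (map-upTo suc B) (cong (applyUpTo suc) B≡)) ⟩
    filter (Reaches? G) (applyUpTo suc (V + (18 + (B ∸ G))))
        ≡⟨ reachers V (B ∸ G) ⟩
    applyUpTo suc V ++ map (suc V +_) gaps ∎
    where
    open ≡-Reasoning
    arith : ∀ V t → suc V + 17 + t ≡ V + (18 + t)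
    arith = solve-∀
    B≡ : B ≡ V + (18 + (B ∸ G))
    B≡ = trans (sym (m+[n∸m]≡n G≤B)) (arith V (B ∸ G))

  count : ∀ {B} → G ≤ B → nUpTo A p B ≡ 30 * m + 6 * j + 8
  count {B} G≤B = begin
    length (repsUpTo A p B)                          ≡⟨ cong length (solutions G≤B) ⟩
    length (applyUpTo suc V ++ map (suc V +_) gaps)  ≡⟨ length-++ (applyUpTo suc V) ⟩
    length (applyUpTo suc V) + 9                     ≡⟨ cong (_+ 9) (length-applyUpTo suc V) ⟩
    V + 9                                            ≡⟨ arith m i ⟩
    30 * m + 6 * j + 8                               ∎
    where
    open ≡-Reasoning
    arith : ∀ m i → m * 30 + 5 + 6 * i + 9 ≡ 30 * m + 6 * suc i + 8
    arith = solve-∀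

  total : ∀ {B} → G ≤ B → sUpTo A p B ≡ 3 * (150 * m * m + 5 * (12 * j + 17) * m + 6 * j * j + 17 * j + 23)
  total {B} G≤B = *-cancelʳ-≡ _ _ 2 (begin
    sum (repsUpTo A p B) * 2                                 ≡⟨ cong (λ xs → sum xs * 2) (solutions G≤B) ⟩
    sum (applyUpTo suc V ++ map (suc V +_) gaps) * 2         ≡⟨ cong (_* 2) (sum-++ (applyUpTo suc V) _) ⟩
    (sum (applyUpTo suc V) + sum (map (suc V +_) gaps)) * 2  ≡⟨ cong₂ (λ x y → (x + y) * 2) (sum-applyUpTo-suc V) (sum-map-+ (suc V) gaps) ⟩
    (triangular V + (9 * suc V + 69)) * 2                    ≡⟨ *-distribʳ-+ 2 (triangular V) _ ⟩
    triangular V * 2 + (9 * suc V + 69) * 2                  ≡⟨ cong (_+ (9 * suc V + 69) * 2) (triangular-double V) ⟩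
    V * suc V + (9 * suc V + 69) * 2                         ≡⟨ arith m i ⟩
    3 * (150 * m * m + 5 * (12 * j + 17) * m + 6 * j * j + 17 * j + 23) * 2 ∎)
    where
    open ≡-Reasoning
    arith : ∀ m i → let V = m * 30 + 5 + 6 * i in
      V * suc V + (9 * suc V + 69) * 2
        ≡ 3 * (150 * m * m + 5 * (12 * suc i + 17) * m + 6 * suc i * suc i + 17 * suc i + 23) * 2
    arith = solve-∀

  result : IsG A p (30 * m + 6 * j + 17)
         × (∀ B → 30 * m + 6 * j + 17 ≤ B →
              (nUpTo A p B ≡ 30 * m + 6 * j + 8)
            × (sUpTo A p B ≡ 3 * (150 * m * m + 5 * (12 * j + 17) * m + 6 * j * j + 17 * j + 23)))
  result = subst (IsG A p) (sym G-formula) isG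
         , λ B le → let G≤B = subst (_≤ B) G-formula le in count G≤B , total G≤B
    where
    arith : ∀ m i → 30 * m + 6 * suc i + 17 ≡ suc (m * 30 + 5 + 6 * i) + 17
    arith = solve-∀
    G-formula : 30 * m + 6 * j + 17 ≡ G
    G-formula = arith m i

proposition2 : (m j : ℕ) → 1 ≤ j → j ≤ 5 →
    IsG (3 ∷ 6 ∷ 10 ∷ []) (((m + 1) * (5 * m + 2 * j)) / 2) (30 * m + 6 * j + 17)
    × (∀ B → 30 * m + 6 * j + 17 ≤ B →
        (nUpTo (3 ∷ 6 ∷ 10 ∷ []) (((m + 1) * (5 * m + 2 * j)) / 2) B ≡ 30 * m + 6 * j + 8)
        × (sUpTo (3 ∷ 6 ∷ 10 ∷ []) (((m + 1) * (5 * m + 2 * j)) / 2) B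
            ≡ 3 * (150 * m * m + 5 * (12 * j + 17) * m + 6 * j * j + 17 * j + 23)))
proposition2 m zero    () _
proposition2 m (suc i) _  j≤5 rewrite half-level m (suc i) = Threshold.result i m (table j≤5)
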